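{- Let $q$ be a prime power, let $0<k<n$ and $0\le t\le k$ be integers. The graph $\Delta_t(n,k-1)$ is connected if and only if the graph $\widetilde{\Lambda}_t(n,k)$ is connected. In particular, $\Lambda_t(n,k)$ is the disjoint union of $\widetilde{\Lambda}_t(n,k)$ and the set $\mathcal{I}_t(n,k)$ of isolated vertices (which span no edges).
   Context: Let $V=\mathbb{F}_q^n$ with its standard basis. For $0\le m\le n$, an $[n,m]$-linear code is an $m$-dimensional subspace of $V$; a generator matrix of it is an $m\times n$ matrix whose rows form a basis of it. For an integer $t\ge 0$, $\mathcal{C}_t(n,m)$ denotes the set of $[n,m]$-codes such that any $t$ columns of a generator matrix are linearly independent (equivalently, the dual code has minimum Hamming distance at least $t+1$; this does not depend on the generator matrix). $\Delta_t(n,m)$ is the graph with vertex set $\mathcal{C}_t(n,m)$ in which $X,Y$ are adjacent iff $\dim(X\cap Y)=m-1$. $\Lambda_t(n,k)$ is the graph with vertex set $\mathcal{C}_t(n,k)$ in which $X,Y$ are adjacent iff $X\cap Y\in\mathcal{C}_t(n,k-1)$. A code $C\in\mathcal{C}_t(n,k)$ is isolated if it contains no subspace $D\in\mathcal{C}_t(n,k-1)$; $\mathcal{I}_t(n,k)$ is the set of isolated codes. $\widetilde{\Lambda}_t(n,k)$ is the subgraph of $\Lambda_t(n,k)$ induced on $\mathcal{C}_t(n,k)\setminus\mathcal{I}_t(n,k)$. The empty graph is considered connected. -}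

module Defs where

open import Level using (0ℓ)
open import Data.Nat using (ℕ; zero; suc; _∸_)
open import Data.Fin using (Fin; zero; suc)
open import Data.Product using (Σ; _×_; _,_; ∃)
open import Relation.Binary.PropositionalEquality using (_≡_; _≢_)
open import Relation.Nullary using (¬_)
open import Algebra.Core using (Op₁; Op₂)
open import Algebra.Structures using (IsCommutativeRing)
open import Function.Bundles using (_↔_)
open import Function.Definitions using (Injective)

-- Every finite field has prime-power order q; conversely the theorem is
-- stated for every finite field, i.e. for every prime power q.
record FiniteField : Set₁ where
  field
    Carrier : Set
    _+_ _*_ : Op₂ Carrier
    -_      : Op₁ Carrier
    0# 1#   : Carrier
    isCommutativeRing : IsCommutativeRing _≡_ _+_ _*_ -_ 0# 1#
    0≢1     : 0# ≢ 1#
    inverse : ∀ x → x ≢ 0# → Σ Carrier (λ y → (x * y) ≡ 1#)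
    q       : ℕ
    enum    : Carrier ↔ Fin q

module Codes (F : FiniteField) where
  open FiniteField F

  Σᶠ : (m : ℕ) → (Fin m → Carrier) → Carrier
  Σᶠ zero    f = 0#
  Σᶠ (suc m) f = f zero + Σᶠ m (λ i → f (suc i))

  Vec : ℕ → Set
  Vec n = Fin n → Carrier

  Mat : ℕ → ℕ → Set
  Mat m n = Fin m → Fin n → Carrier

  Sub : ℕ → Set₁
  Sub n = Vec n → Set

  _⊆_ : ∀ {n} → Sub n → Sub n → Set
  X ⊆ Y = ∀ v → X v → Y v

  _≐_ : ∀ {n} → Sub n → Sub n → Set
  X ≐ Y = (X ⊆ Y) × (Y ⊆ X)

  _∩_ : ∀ {n} → Sub n → Sub n → Sub n
  (X ∩ Y) v = X v × Y v

  span : ∀ {m n} → Mat m n → Sub n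
  span {m} {n} G v = Σ (Vec m) λ c → ∀ j → v j ≡ Σᶠ m (λ i → c i * G i j)

  RowsIndep : ∀ {m n} → Mat m n → Set
  RowsIndep {m} {n} G =
    ∀ (c : Vec m) → (∀ j → Σᶠ m (λ i → c i * G i j) ≡ 0#) → ∀ i → c i ≡ 0#

  TColsIndep : ℕ → ∀ {m n} → Mat m n → Set
  TColsIndep t {m} {n} G =
    ∀ (f : Fin t → Fin n) → Injective _≡_ _≡_ f →
    ∀ (c : Vec t) → (∀ i → Σᶠ t (λ j → G i (f j) * c j) ≡ 0#) → ∀ j → c j ≡ 0#

  InC : ℕ → ∀ {m n} → Mat m n → Set
  InC t G = RowsIndep G × TColsIndep t G

  HasDim : ∀ {n} → ℕ → Sub n → Set
  HasDim {n} d S = Σ (Mat d n) λ B → RowsIndep B × (span B ≐ S)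

  IsCodeC : ℕ → ∀ {n} → ℕ → Sub n → Set
  IsCodeC t {n} d S = Σ (Mat d n) λ B → InC t B × (span B ≐ S)

  AdjΔ : ∀ {m n} → Mat m n → Mat m n → Set
  AdjΔ {m} G H = Σ ℕ λ d → (suc d ≡ m) × HasDim d (span G ∩ span H)

  AdjΛ : ℕ → ∀ {k n} → Mat k n → Mat k n → Set
  AdjΛ t {k} G H = Σ ℕ λ d → (suc d ≡ k) × IsCodeC t d (span G ∩ span H)

  Isolated : ℕ → ∀ {k n} → Mat k n → Set
  Isolated t {k} {n} G =
    ¬ (Σ (Mat (k ∸ 1) n) λ D → InC t D × (span D ⊆ span G))

  -- Reachability in a graph whose vertices are codes (given by generator
  -- matrices; two matrices with the same row space are the same vertex),
  -- vertex predicate V and adjacency A; all intermediate vertices lie in V.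
  data Reach {m n} (V : Mat m n → Set) (A : Mat m n → Mat m n → Set)
             : Mat m n → Mat m n → Set where
    same : ∀ {G H} → span G ≐ span H → Reach V A G H
    step : ∀ {G G' H} → A G G' → V G' → Reach V A G' H → Reach V A G H

  Connected : ∀ {m n} → (Mat m n → Set) → (Mat m n → Mat m n → Set) → Set
  Connected V A = ∀ G H → V G → V H → Reach V A G H

  ConnectedΔ : ℕ → ℕ → ℕ → Set
  ConnectedΔ t n m = Connected {m} {n} (InC t) AdjΔ

  VΛ̃ : ℕ → ∀ {k n} → Mat k n → Set
  VΛ̃ t G = InC t G × ¬ Isolated t G

  ConnectedΛ̃ : ℕ → ℕ → ℕ → Set
  ConnectedΛ̃ t n k = Connected {k} {n} (VΛ̃ t) (AdjΛ t)

{-# OPTIONS --safe #-}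
module Submission where

-- A non-isolated code C ∈ 𝒞_t(n,k) contains some D ∈ 𝒞_t(n,k-1); conversely every
-- D ∈ 𝒞_t(n,k-1) lies in the non-isolated code D + ⟨w⟩ ∈ 𝒞_t(n,k) for any w ∉ D, since adding a
-- row keeps every t columns independent.  Two k-codes through a common D are equal or Λ-adjacent
-- (their intersection is D), and two (k-1)-codes inside a common k-space are equal or Δ-adjacent
-- (their intersection has codimension one).  If D and D′ are Δ-adjacent, D + D′ = D + ⟨w⟩ for any
-- w ∈ D′ ∖ D is a k-code containing both.  So walks in Δ_t(n,k-1) lift to walks in Λ̃_t(n,k) and
-- walks in Λ̃_t(n,k) project to walks in Δ_t(n,k-1).  An isolated code contains no member of
-- 𝒞_t(n,k-1), in particular no intersection with a neighbour.

open import Defs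
open import Level using (0ℓ)
open import Algebra.Bundles using (CommutativeRing)
open import Data.Nat using (ℕ; zero; suc; _<_; _≤_; _∸_; z≤n; s≤s)
open import Data.Nat.Properties using (≤-refl; ≤-trans; ≤-antisym; ≤-pred; <⇒≤; m≤n⇒m≤1+n; n≮n)
open import Data.Fin using (Fin; zero; suc; punchIn)
open import Data.Fin.Properties using (punchInᵢ≢i; any?; all?; inj⇒≟) renaming (_≟_ to _≟ᶠ_)
open import Data.Vec.Functional using (_∷_; insertAt)
open import Data.Vec.Functional.Properties using (insertAt-lookup; insertAt-punchIn)
open import Data.Vec.Functional.Relation.Binary.Pointwise using (Pointwise)
open import Data.Product using (∃; _×_; _,_; proj₁; proj₂)
open import Data.Empty using (⊥-elim)
open import Data.Sum using (_⊎_; inj₁; inj₂)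
open import Function.Base using (_∘_)
open import Function.Bundles using (Inverse; _⇔_; mk⇔)
open import Function.Definitions using (Injective)
open import Function.Properties.Inverse using (↔⇒↣)
open import Relation.Binary.Core using (Rel)
open import Relation.Binary.Definitions using (Reflexive; Symmetric; _Respects_)
open import Relation.Nullary using (¬_; Dec; yes; no; ¬?)
open import Relation.Nullary.Decidable using (_×-dec_; _→-dec_; map′; decidable-stable)
open import Relation.Unary using (Pred; Decidable)
open import Relation.Binary.PropositionalEquality
  using (_≡_; _≢_; _≗_; refl; sym; trans; cong; cong₂; module ≡-Reasoning)

module LinearAlgebra (F : FiniteField) where
  open FiniteField F using (0≢1; inverse; enum)
  open Codes F

  commutativeRing : CommutativeRing 0ℓ 0ℓ
  commutativeRing = record { isCommutativeRing = FiniteField.isCommutativeRing F }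

  open CommutativeRing commutativeRing
    using ( Carrier; _+_; _*_; -_; _-_; 0#; 1#; +-assoc; +-comm; *-assoc; *-comm
          ; distribˡ; distribʳ; zeroˡ; zeroʳ; +-identityˡ; +-identityʳ; *-identityˡ; *-identityʳ
          ; ring; semiring; +-abelianGroup)
  open import Algebra.Properties.Ring ring using (-‿distribˡ-*; -‿distribʳ-*; -1*x≈-x)
  open import Algebra.Properties.AbelianGroup +-abelianGroup
    using (⁻¹-involutive; inverseʳ-unique; //-rightDividesʳ; ⁻¹-∙-comm; xyx⁻¹≈y)
  open import Algebra.Properties.Semiring.Sum semiring
    using (sum; sum-cong-≗; sum-replicate-zero; ∑-distrib-+; *-distribˡ-sum; *-distribʳ-sum; sum-remove)
  open ≡-Reasoning

  _≟_ : (x y : Carrier) → Dec (x ≡ y)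
  _≟_ = inj⇒≟ (↔⇒↣ enum)

  -x*-y≡x*y : ∀ x y → - x * - y ≡ x * y
  -x*-y≡x*y x y = begin
    - x * - y     ≡⟨ -‿distribˡ-* x (- y) ⟨
    - (x * - y)   ≡⟨ cong -_ (-‿distribʳ-* x y) ⟨
    - - (x * y)   ≡⟨ ⁻¹-involutive (x * y) ⟩
    x * y         ∎

  inverse-cancelˡ : ∀ {x x⁻¹} → x * x⁻¹ ≡ 1# → ∀ y → x⁻¹ * (x * y) ≡ y
  inverse-cancelˡ {x} {x⁻¹} inv y = begin
    x⁻¹ * (x * y)  ≡⟨ *-assoc x⁻¹ x y ⟨
    x⁻¹ * x * y    ≡⟨ cong (_* y) (trans (*-comm x⁻¹ x) inv) ⟩
    1# * y         ≡⟨ *-identityˡ y ⟩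
    y              ∎

  inverse-cancelʳ : ∀ {x x⁻¹} → x * x⁻¹ ≡ 1# → ∀ y → y * x⁻¹ * x ≡ y
  inverse-cancelʳ {x} {x⁻¹} inv y = begin
    y * x⁻¹ * x    ≡⟨ *-assoc y x⁻¹ x ⟩
    y * (x⁻¹ * x)  ≡⟨ cong (y *_) (trans (*-comm x⁻¹ x) inv) ⟩
    y * 1#         ≡⟨ *-identityʳ y ⟩
    y              ∎

  solve-linear : ∀ {x x⁻¹ y z} → x * x⁻¹ ≡ 1# → x * y + z ≡ 0# → y ≡ - x⁻¹ * z
  solve-linear {x} {x⁻¹} {y} {z} inv eq = sym (begin
    - x⁻¹ * z            ≡⟨ cong (- x⁻¹ *_) (inverseʳ-unique (x * y) z eq) ⟩
    - x⁻¹ * - (x * y)    ≡⟨ -x*-y≡x*y x⁻¹ (x * y) ⟩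
    x⁻¹ * (x * y)        ≡⟨ inverse-cancelˡ inv y ⟩
    y                    ∎)

  [a+r]-[a+s]≡r-s : ∀ a r s → (a + r) - (a + s) ≡ r - s
  [a+r]-[a+s]≡r-s a r s = begin
    (a + r) + - (a + s)    ≡⟨ cong ((a + r) +_) (⁻¹-∙-comm a s) ⟨
    (a + r) + (- a + - s)  ≡⟨ +-assoc (a + r) (- a) (- s) ⟨
    (a + r) + - a + - s    ≡⟨ cong (_+ - s) (xyx⁻¹≈y a r) ⟩
    r - s                  ∎

  eliminate-pivot : ∀ {α α′ β} → β * α′ ≡ α →
                    ∀ x r r′ → (α * x + r) - β * (α′ * x + r′) ≡ r - β * r′
  eliminate-pivot {α} {α′} {β} eq x r r′ = begin
    (α * x + r) - β * (α′ * x + r′)      ≡⟨ cong (λ u → (α * x + r) - u) (distribˡ β (α′ * x) r′) ⟩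
    (α * x + r) - (β * (α′ * x) + β * r′) ≡⟨ cong (λ u → (α * x + r) - (u + β * r′))
                                                   (trans (sym (*-assoc β α′ x)) (cong (_* x) eq)) ⟩
    (α * x + r) - (α * x + β * r′)        ≡⟨ [a+r]-[a+s]≡r-s (α * x) r (β * r′) ⟩
    r - β * r′                            ∎

  Σᶠ≡sum : ∀ m (f : Fin m → Carrier) → Σᶠ m f ≡ sum f
  Σᶠ≡sum zero    f = refl
  Σᶠ≡sum (suc m) f = cong (f zero +_) (Σᶠ≡sum m (f ∘ suc))

  Σᶠ-cong : ∀ m {f g : Fin m → Carrier} → f ≗ g → Σᶠ m f ≡ Σᶠ m g
  Σᶠ-cong m {f} {g} f≗g = trans (Σᶠ≡sum m f) (trans (sum-cong-≗ f≗g) (sym (Σᶠ≡sum m g)))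

  Σᶠ-zero : ∀ m {f : Fin m → Carrier} → (∀ i → f i ≡ 0#) → Σᶠ m f ≡ 0#
  Σᶠ-zero m {f} f≡0 = trans (Σᶠ-cong m f≡0) (trans (Σᶠ≡sum m _) (sum-replicate-zero m))

  Σᶠ-+ : ∀ m (f g : Fin m → Carrier) → Σᶠ m (λ i → f i + g i) ≡ Σᶠ m f + Σᶠ m g
  Σᶠ-+ m f g = begin
    Σᶠ m (λ i → f i + g i)  ≡⟨ Σᶠ≡sum m _ ⟩
    sum (λ i → f i + g i)   ≡⟨ ∑-distrib-+ f g ⟩
    sum f + sum g           ≡⟨ cong₂ _+_ (Σᶠ≡sum m f) (Σᶠ≡sum m g) ⟨
    Σᶠ m f + Σᶠ m g         ∎

  *-Σᶠ : ∀ m a (f : Fin m → Carrier) → a * Σᶠ m f ≡ Σᶠ m (λ i → a * f i)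
  *-Σᶠ m a f = begin
    a * Σᶠ m f              ≡⟨ cong (a *_) (Σᶠ≡sum m f) ⟩
    a * sum f               ≡⟨ *-distribˡ-sum a f ⟩
    sum (λ i → a * f i)     ≡⟨ Σᶠ≡sum m _ ⟨
    Σᶠ m (λ i → a * f i)    ∎

  Σᶠ-* : ∀ m a (f : Fin m → Carrier) → Σᶠ m f * a ≡ Σᶠ m (λ i → f i * a)
  Σᶠ-* m a f = begin
    Σᶠ m f * a              ≡⟨ cong (_* a) (Σᶠ≡sum m f) ⟩
    sum f * a               ≡⟨ *-distribʳ-sum a f ⟩
    sum (λ i → f i * a)     ≡⟨ Σᶠ≡sum m _ ⟨
    Σᶠ m (λ i → f i * a)    ∎

  Σᶠ-remove : ∀ m (p : Fin (suc m)) (f : Fin (suc m) → Carrier) → Σᶠ (suc m) f ≡ f p + Σᶠ m (f ∘ punchIn p)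
  Σᶠ-remove m p f = begin
    Σᶠ (suc m) f              ≡⟨ Σᶠ≡sum (suc m) f ⟩
    sum f                     ≡⟨ sum-remove f ⟩
    f p + sum (f ∘ punchIn p) ≡⟨ cong (f p +_) (Σᶠ≡sum m _) ⟨
    f p + Σᶠ m (f ∘ punchIn p) ∎

  Σᶠ-zero-head : ∀ m (f : Fin (suc m) → Carrier) → f zero ≡ 0# → Σᶠ (suc m) f ≡ Σᶠ m (f ∘ suc)
  Σᶠ-zero-head m f f₀≡0 = trans (cong (_+ Σᶠ m (f ∘ suc)) f₀≡0) (+-identityˡ _)

  δ : ∀ {m} → Fin m → Fin m → Carrier
  δ i j with i ≟ᶠ j
  ... | yes _ = 1#
  ... | no  _ = 0#

  δ-refl : ∀ {m} (i : Fin m) → δ i i ≡ 1#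
  δ-refl i with i ≟ᶠ i
  ... | yes _   = refl
  ... | no  i≢i = ⊥-elim (i≢i refl)

  δ-≢ : ∀ {m} {i j : Fin m} → i ≢ j → δ i j ≡ 0#
  δ-≢ {i = i} {j} i≢j with i ≟ᶠ j
  ... | yes i≡j = ⊥-elim (i≢j i≡j)
  ... | no  _   = refl

  Σᶠ-δ : ∀ m (p : Fin m) (f : Fin m → Carrier) → Σᶠ m (λ i → δ p i * f i) ≡ f p
  Σᶠ-δ (suc m) p f = begin
    Σᶠ (suc m) (λ i → δ p i * f i)                           ≡⟨ Σᶠ-remove m p (λ i → δ p i * f i) ⟩
    δ p p * f p + Σᶠ m (λ i → δ p (punchIn p i) * f (punchIn p i))
      ≡⟨ cong₂ _+_ (trans (cong (_* f p) (δ-refl p)) (*-identityˡ (f p)))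
                   (Σᶠ-zero m (λ i → trans (cong (_* _) (δ-≢ (punchInᵢ≢i p i ∘ sym))) (zeroˡ _))) ⟩
    f p + 0#                                                 ≡⟨ +-identityʳ (f p) ⟩
    f p                                                      ∎

  -- The field is finite, so predicates on vectors are decided by exhaustive search; this is what
  -- turns "C is not isolated" into an actual subcode, and "span Z ≠ 𝔽_q^n" into a vector outside it.
  Searchable : (A : Set) → Rel A 0ℓ → Set₁
  Searchable A _≈_ = ∀ {P : Pred A 0ℓ} → P Respects _≈_ → Decidable P → Dec (∃ P)

  search-Fin : ∀ k → Searchable (Fin k) _≡_
  search-Fin k _ = any?

  search-Carrier : Searchable Carrier _≡_
  search-Carrier {P} resp P? =
    map′ (λ (i , p) → from i , p) (λ (x , px) → to x , resp (sym (strictlyInverseʳ x)) px) (any? (P? ∘ from))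
    where open Inverse enum

  search-Vector : ∀ {A : Set} {_≈_ : Rel A 0ℓ} → Reflexive _≈_ → Searchable A _≈_ →
                  ∀ m → Searchable (Fin m → A) (Pointwise _≈_)
  search-Vector refl≈ search zero resp P? =
    map′ (λ p → _ , p) (λ (f , pf) → resp (λ ()) pf) (P? λ ())
  search-Vector {A} {_≈_} refl≈ search (suc m) {P} resp P? =
    map′ (λ (a , c , p) → a ∷ c , p) (λ (f , pf) → f zero , f ∘ suc , resp η pf) (search resp-tail tail?)
    where
    ∷-congˡ : ∀ {x y} (c : Fin m → A) → x ≈ y → Pointwise _≈_ (x ∷ c) (y ∷ c)
    ∷-congˡ c x≈y zero    = x≈y
    ∷-congˡ c x≈y (suc i) = refl≈
    η : ∀ {f} → Pointwise _≈_ f (f zero ∷ f ∘ suc)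
    η zero    = refl≈
    η (suc i) = refl≈
    resp-tail : (λ a → ∃ λ c → P (a ∷ c)) Respects _≈_
    resp-tail x≈y (c , p) = c , resp (∷-congˡ c x≈y) p
    tail? : Decidable (λ a → ∃ λ c → P (a ∷ c))
    tail? a = search-Vector refl≈ search m (λ c≈d → resp (λ { zero → refl≈ ; (suc i) → c≈d i })) (P? ∘ (a ∷_))

  search-∀ : ∀ {A : Set} {_≈_ : Rel A 0ℓ} → Symmetric _≈_ → Searchable A _≈_ →
             ∀ {P : Pred A 0ℓ} → P Respects _≈_ → Decidable P → Dec (∀ x → P x)
  search-∀ sym≈ search {P} resp P? with search (λ x≈y ¬px py → ¬px (resp (sym≈ x≈y) py)) (¬? ∘ P?)
  ... | yes (x , ¬px) = no λ ∀P → ¬px (∀P x)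
  ... | no  ∄¬P       = yes λ x → decidable-stable (P? x) λ ¬px → ∄¬P (x , ¬px)

  search-Vec : ∀ m → Searchable (Vec m) _≗_
  search-Vec = search-Vector refl search-Carrier

  search-Mat : ∀ m n → Searchable (Mat m n) (Pointwise _≗_)
  search-Mat m n = search-Vector (λ _ → refl) (search-Vec n) m

  search-Fin→Fin : ∀ t n → Searchable (Fin t → Fin n) _≗_
  search-Fin→Fin t n = search-Vector refl (search-Fin n) t

  ⊆-trans : ∀ {n} {X Y Z : Sub n} → X ⊆ Y → Y ⊆ Z → X ⊆ Z
  ⊆-trans X⊆Y Y⊆Z v = Y⊆Z v ∘ X⊆Y v

  ≐-refl : ∀ {n} {X : Sub n} → X ≐ X
  ≐-refl = (λ _ x → x) , (λ _ x → x)

  ≐-sym : ∀ {n} {X Y : Sub n} → X ≐ Y → Y ≐ X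
  ≐-sym (X⊆Y , Y⊆X) = Y⊆X , X⊆Y

  ≐-trans : ∀ {n} {X Y Z : Sub n} → X ≐ Y → Y ≐ Z → X ≐ Z
  ≐-trans (X⊆Y , Y⊆X) (Y⊆Z , Z⊆Y) = ⊆-trans X⊆Y Y⊆Z , ⊆-trans Z⊆Y Y⊆X

  ∩-congˡ : ∀ {n} {X X′ Y : Sub n} → X ≐ X′ → (X ∩ Y) ≐ (X′ ∩ Y)
  ∩-congˡ (X⊆X′ , X′⊆X) = (λ v (x , y) → X⊆X′ v x , y) , (λ v (x , y) → X′⊆X v x , y)

  module _ {m n : ℕ} {G : Mat m n} where

    span-resp : span G Respects _≗_
    span-resp v≗w (c , v≡) = c , λ j → trans (sym (v≗w j)) (v≡ j)

    span-0 : span G (λ _ → 0#)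
    span-0 = (λ _ → 0#) , λ j → sym (Σᶠ-zero m λ i → zeroˡ (G i j))

    span-+ : ∀ {v w} → span G v → span G w → span G (λ j → v j + w j)
    span-+ {v} {w} (c , v≡) (d , w≡) = (λ i → c i + d i) , λ j → begin
      v j + w j                                                   ≡⟨ cong₂ _+_ (v≡ j) (w≡ j) ⟩
      Σᶠ m (λ i → c i * G i j) + Σᶠ m (λ i → d i * G i j)         ≡⟨ Σᶠ-+ m _ _ ⟨
      Σᶠ m (λ i → c i * G i j + d i * G i j)                      ≡⟨ Σᶠ-cong m (λ i → sym (distribʳ (G i j) (c i) (d i))) ⟩
      Σᶠ m (λ i → (c i + d i) * G i j)                            ∎

    span-* : ∀ a {v} → span G v → span G (λ j → a * v j)
    span-* a {v} (c , v≡) = (λ i → a * c i) , λ j → begin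
      a * v j                              ≡⟨ cong (a *_) (v≡ j) ⟩
      a * Σᶠ m (λ i → c i * G i j)         ≡⟨ *-Σᶠ m a _ ⟩
      Σᶠ m (λ i → a * (c i * G i j))       ≡⟨ Σᶠ-cong m (λ i → sym (*-assoc a (c i) (G i j))) ⟩
      Σᶠ m (λ i → a * c i * G i j)         ∎

    span-sub : ∀ {v w} → span G v → span G w → span G (λ j → v j - w j)
    span-sub v∈ w∈ = span-+ v∈ (span-resp (λ j → -1*x≈-x _) (span-* (- 1#) w∈))

    span-+-cancelˡ : ∀ {v w} → span G (λ j → v j + w j) → span G v → span G w
    span-+-cancelˡ {v} {w} v+w∈G v∈G = span-resp (λ j → xyx⁻¹≈y (v j) (w j)) (span-sub v+w∈G v∈G)

    span-combination : ∀ {k} (A : Mat k n) (c : Vec k) → (∀ i → span G (A i)) →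
                       span G (λ j → Σᶠ k (λ i → c i * A i j))
    span-combination {zero}  A c A⊆G = span-0
    span-combination {suc k} A c A⊆G =
      span-+ (span-* (c zero) (A⊆G zero)) (span-combination (A ∘ suc) (c ∘ suc) (A⊆G ∘ suc))

    span-least : ∀ {k} {A : Mat k n} → (∀ i → span G (A i)) → span A ⊆ span G
    span-least {A = A} A⊆G v (c , v≡) = span-resp (sym ∘ v≡) (span-combination A c A⊆G)

  span-row : ∀ {m n} (G : Mat m n) i → span G (G i)
  span-row {m} G i = δ i , λ j → sym (Σᶠ-δ m i (λ r → G r j))

  span-tail : ∀ {m n} {G : Mat (suc m) n} → span (G ∘ suc) ⊆ span G
  span-tail {m} {G = G} v (c , v≡) =
    0# ∷ c , λ j → trans (v≡ j) (sym (Σᶠ-zero-head m (λ i → (0# ∷ c) i * G i j) (zeroˡ (G zero j))))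

  span-∷-mono : ∀ {m k n} {A : Mat m n} {B : Mat k n} {w} → span A ⊆ span B → span (w ∷ A) ⊆ span (w ∷ B)
  span-∷-mono {A = A} {B} {w} A⊆B = span-least {G = w ∷ B} rows
    where
    rows : ∀ i → span (w ∷ B) ((w ∷ A) i)
    rows zero    = span-row (w ∷ B) zero
    rows (suc i) = span-tail {G = w ∷ B} (A i) (A⊆B (A i) (span-row A i))

  span? : ∀ {m n} (G : Mat m n) → Decidable (span G)
  span? {m} {n} G v = search-Vec m (λ c≗d v≡ j → trans (v≡ j) (Σᶠ-cong m λ i → cong (_* G i j) (c≗d i)))
                                   (λ c → all? λ j → v j ≟ Σᶠ m (λ i → c i * G i j))

  rowsIndep-∷ : ∀ {m n} {A : Mat m n} {w} → RowsIndep A → ¬ span A w → RowsIndep (w ∷ A)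
  rowsIndep-∷ {m} {A = A} {w} indep w∉A c c·wA≡0 with c zero ≟ 0#
  ... | yes c₀≡0 = λ { zero → c₀≡0 ; (suc i) → indep (c ∘ suc) c·A≡0 i }
    where
    c·A≡0 : ∀ j → Σᶠ m (λ i → c (suc i) * A i j) ≡ 0#
    c·A≡0 j = trans (sym (Σᶠ-zero-head m (λ i → c i * (w ∷ A) i j) (trans (cong (_* w j) c₀≡0) (zeroˡ (w j)))))
                    (c·wA≡0 j)
  ... | no  c₀≢0 = ⊥-elim (w∉A (span-resp (λ j → sym (solve-linear c₀⁻¹-inv (c·wA≡0 j)))
                                          (span-* {G = A} (- c₀⁻¹) (c ∘ suc , λ j → refl))))
    where
    c₀⁻¹ = proj₁ (inverse (c zero) c₀≢0)
    c₀⁻¹-inv = proj₂ (inverse (c zero) c₀≢0)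

  rowsIndep-addRow : ∀ {a n} {A : Mat (suc a) n} (p : Fin (suc a)) (β : Vec a) → RowsIndep A →
                     RowsIndep (λ i j → A (punchIn p i) j + β i * A p j)
  rowsIndep-addRow {a} {A = A} p β indep c c·A′≡0 i =
    trans (sym (insertAt-punchIn c p γ i)) (indep e e·A≡0 (punchIn p i))
    where
    γ = Σᶠ a (λ i → c i * β i)
    e = insertAt c p γ
    e·A≡0 : ∀ j → Σᶠ (suc a) (λ x → e x * A x j) ≡ 0#
    e·A≡0 j = begin
      Σᶠ (suc a) (λ x → e x * A x j)
        ≡⟨ Σᶠ-remove a p (λ x → e x * A x j) ⟩
      e p * A p j + Σᶠ a (λ i → e (punchIn p i) * A (punchIn p i) j)
        ≡⟨ cong₂ _+_ (cong (_* A p j) (insertAt-lookup c p γ))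
                     (Σᶠ-cong a λ i → cong (_* A (punchIn p i) j) (insertAt-punchIn c p γ i)) ⟩
      γ * A p j + c·Aᵣ
        ≡⟨ +-comm _ c·Aᵣ ⟩
      c·Aᵣ + γ * A p j
        ≡⟨ cong (c·Aᵣ +_) (trans (Σᶠ-* a (A p j) _) (Σᶠ-cong a λ i → *-assoc (c i) (β i) (A p j))) ⟩
      c·Aᵣ + Σᶠ a (λ i → c i * (β i * A p j))
        ≡⟨ Σᶠ-+ a _ _ ⟨
      Σᶠ a (λ i → c i * A (punchIn p i) j + c i * (β i * A p j))
        ≡⟨ Σᶠ-cong a (λ i → sym (distribˡ (c i) _ _)) ⟩
      Σᶠ a (λ i → c i * (A (punchIn p i) j + β i * A p j))
        ≡⟨ c·A′≡0 j ⟩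
      0# ∎
      where c·Aᵣ = Σᶠ a (λ i → c i * A (punchIn p i) j)

  -- Steinitz exchange by induction on b: a row of A with a nonzero coefficient on B zero is used
  -- as a pivot to eliminate that coefficient from the other rows.
  rowsIndep-≤ : ∀ {a b n} (A : Mat a n) (B : Mat b n) → RowsIndep A → (∀ i → span B (A i)) → a ≤ b
  rowsIndep-≤ {zero} A B _ _ = z≤n
  rowsIndep-≤ {suc a} {zero} A B indep A⊆B =
    ⊥-elim (0≢1 (sym (indep (λ _ → 1#) (λ j → Σᶠ-zero (suc a) λ i → trans (*-identityˡ _) (proj₂ (A⊆B i) j))
                            zero)))
  rowsIndep-≤ {suc a} {suc b} {n} A B indep A⊆B = by-pivot (any? λ i → ¬? (α i ≟ 0#))
    where
    α : Vec (suc a)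
    α i = proj₁ (A⊆B i) zero
    R : Mat (suc a) n
    R i j = Σᶠ b (λ r → proj₁ (A⊆B i) (suc r) * B (suc r) j)
    R∈ : ∀ i → span (B ∘ suc) (R i)
    R∈ i = proj₁ (A⊆B i) ∘ suc , λ j → refl
    A≡ : ∀ i j → A i j ≡ α i * B zero j + R i j
    A≡ i = proj₂ (A⊆B i)
    by-pivot : Dec (∃ λ i → α i ≢ 0#) → suc a ≤ suc b
    by-pivot (no ∄pivot) = m≤n⇒m≤1+n (rowsIndep-≤ A (B ∘ suc) indep λ i → span-resp (A≡R i) (R∈ i))
      where
      A≡R : ∀ i j → R i j ≡ A i j
      A≡R i j = sym (trans (A≡ i j) (Σᶠ-zero-head b (λ r → proj₁ (A⊆B i) r * B r j)
                  (trans (cong (_* B zero j) (decidable-stable (α i ≟ 0#) λ αᵢ≢0 → ∄pivot (i , αᵢ≢0))) (zeroˡ _))))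
    by-pivot (yes (p , αₚ≢0)) = s≤s (rowsIndep-≤ _ (B ∘ suc) (rowsIndep-addRow {A = A} p (λ i → - β i) indep) A′∈)
      where
      αₚ⁻¹ = proj₁ (inverse (α p) αₚ≢0)
      β : Vec a
      β i = α (punchIn p i) * αₚ⁻¹
      β-pivot : ∀ i → β i * α p ≡ α (punchIn p i)
      β-pivot i = inverse-cancelʳ (proj₂ (inverse (α p) αₚ≢0)) (α (punchIn p i))
      A′∈ : ∀ i → span (B ∘ suc) (λ j → A (punchIn p i) j + - β i * A p j)
      A′∈ i = span-resp (λ j → sym (begin
        A q j + - β i * A p j   ≡⟨ cong (A q j +_) (-‿distribˡ-* (β i) (A p j)) ⟨
        A q j - β i * A p j     ≡⟨ cong₂ (λ x y → x - β i * y) (A≡ q j) (A≡ p j) ⟩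
        (α q * B zero j + R q j) - β i * (α p * B zero j + R p j)
                                ≡⟨ eliminate-pivot (β-pivot i) (B zero j) (R q j) (R p j) ⟩
        R q j - β i * R p j     ∎))
        (span-sub {G = B ∘ suc} (R∈ q) (span-* (β i) (R∈ p)))
        where q = punchIn p i

  rowsIndep-span-≐ : ∀ {a b n} (A : Mat a n) (B : Mat b n) → RowsIndep A → b ≤ a →
                     (∀ i → span B (A i)) → span A ≐ span B
  rowsIndep-span-≐ {a} A B indep b≤a A⊆B = span-least A⊆B , B⊆A
    where
    B⊆A : span B ⊆ span A
    B⊆A v v∈B = decidable-stable (span? A v) λ v∉A →
      n≮n a (≤-trans (rowsIndep-≤ (v ∷ A) B (rowsIndep-∷ {A = A} indep v∉A) λ { zero → v∈B ; (suc i) → A⊆B i })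
                     b≤a)

  span-hasDim : ∀ {m n} (A : Mat m n) → ∃ λ d → HasDim d (span A)
  span-hasDim {zero} A = zero , A , (λ _ _ ()) , ≐-refl
  span-hasDim {suc m} A with span-hasDim (A ∘ suc)
  ... | d , B , indep , B≐A′ with span? B (A zero)
  ...   | yes A₀∈B = d , B , indep , (⊆-trans (proj₁ B≐A′) (span-tail {G = A}) , span-least {G = B} A⊆B)
    where
    A⊆B : ∀ i → span B (A i)
    A⊆B zero    = A₀∈B
    A⊆B (suc i) = proj₂ B≐A′ (A (suc i)) (span-row (A ∘ suc) i)
  ...   | no  A₀∉B = suc d , A zero ∷ B , rowsIndep-∷ indep A₀∉B
                   , (span-least {G = A} A₀B⊆A , span-least {G = A zero ∷ B} A⊆A₀B)
    where
    A₀B⊆A : ∀ i → span A ((A zero ∷ B) i)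
    A₀B⊆A zero    = span-row A zero
    A₀B⊆A (suc i) = span-tail {G = A} (B i) (proj₁ B≐A′ (B i) (span-row B i))
    A⊆A₀B : ∀ i → span (A zero ∷ B) (A i)
    A⊆A₀B zero    = span-row (A zero ∷ B) zero
    A⊆A₀B (suc i) = span-tail {G = A zero ∷ B} (A (suc i)) (proj₂ B≐A′ (A (suc i)) (span-row (A ∘ suc) i))

  span-proper : ∀ {m n} (Z : Mat m n) → m < n → ∃ λ w → ¬ span Z w
  span-proper {m} {n} Z m<n =
    decidable-stable (search-Vec n (λ v≗w v∉ w∈ → v∉ (span-resp (sym ∘ v≗w) w∈)) (¬? ∘ span? Z)) λ ∄w →
      n≮n m (≤-trans m<n (rowsIndep-≤ I Z I-indep λ i →
        decidable-stable (span? Z (I i)) λ Iᵢ∉Z → ∄w (I i , Iᵢ∉Z)))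
    where
    I : Mat n n
    I i j = δ j i
    I-indep : RowsIndep I
    I-indep c c·I≡0 j = trans (sym (Σᶠ-δ n j c)) (trans (Σᶠ-cong n λ i → *-comm (δ j i) (c i)) (c·I≡0 j))

  trivialKernel? : ∀ {k p} (L : Vec k → Vec p) → (∀ {c d} → c ≗ d → L c ≗ L d) →
                   Dec (∀ c → (∀ j → L c j ≡ 0#) → ∀ i → c i ≡ 0#)
  trivialKernel? {k} L L-cong =
    search-∀ (λ c≗d → sym ∘ c≗d) (search-Vec k) resp λ c → all? (λ j → L c j ≟ 0#) →-dec all? (λ i → c i ≟ 0#)
    where
    resp : ∀ {c d} → c ≗ d → ((∀ j → L c j ≡ 0#) → ∀ i → c i ≡ 0#) →
                             (∀ j → L d j ≡ 0#) → ∀ i → d i ≡ 0#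
    resp c≗d c-trivial Ld≡0 i = trans (sym (c≗d i)) (c-trivial (λ j → trans (L-cong c≗d j) (Ld≡0 j)) i)

  rowsIndep? : ∀ {m n} (A : Mat m n) → Dec (RowsIndep A)
  rowsIndep? {m} A = trivialKernel? (λ c j → Σᶠ m (λ i → c i * A i j))
                                    λ c≗d j → Σᶠ-cong m λ i → cong (_* A i j) (c≗d i)

  injective? : ∀ {t n} (f : Fin t → Fin n) → Dec (Injective _≡_ _≡_ f)
  injective? f = map′ (λ inj {x} {y} → inj x y) (λ inj x y → inj {x} {y})
                      (all? λ x → all? λ y → f x ≟ᶠ f y →-dec x ≟ᶠ y)

  tColsIndep? : ∀ t {m n} (A : Mat m n) → Dec (TColsIndep t A)
  tColsIndep? t {m} {n} A =
    search-∀ (λ f≗g → sym ∘ f≗g) (search-Fin→Fin t n) resp λ f → injective? f →-dec columnsIndep? f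
    where
    columns : (Fin t → Fin n) → Vec t → Vec m
    columns f c i = Σᶠ t (λ j → A i (f j) * c j)
    columnsIndep? : ∀ f → Dec (∀ c → (∀ i → columns f c i ≡ 0#) → ∀ j → c j ≡ 0#)
    columnsIndep? f = trivialKernel? (columns f) λ c≗d i → Σᶠ-cong t λ j → cong (A i (f j) *_) (c≗d j)
    resp : ∀ {f g} → f ≗ g → (Injective _≡_ _≡_ f → ∀ c → (∀ i → columns f c i ≡ 0#) → ∀ j → c j ≡ 0#) →
                             Injective _≡_ _≡_ g → ∀ c → (∀ i → columns g c i ≡ 0#) → ∀ j → c j ≡ 0#
    resp f≗g f-indep g-inj c g·c≡0 = f-indep (λ fx≡fy → g-inj (trans (sym (f≗g _)) (trans fx≡fy (f≗g _)))) c
      λ i → trans (Σᶠ-cong t λ j → cong (λ x → A i x * c j) (f≗g j)) (g·c≡0 i)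

  InC-resp : ∀ t {m n} → InC t {m} {n} Respects Pointwise _≗_
  InC-resp t {m} D≗D′ (rows , cols) =
    (λ c c·D′≡0 → rows c λ j → trans (Σᶠ-cong m λ i → cong (c _ *_) (D≗D′ i j)) (c·D′≡0 j)) ,
    (λ f f-inj c D′·c≡0 → cols f f-inj c λ i → trans (Σᶠ-cong t λ j → cong (_* c j) (D≗D′ i (f j))) (D′·c≡0 i))

  subcode? : ∀ t {k m n} (G : Mat k n) → Dec (∃ λ (D : Mat m n) → InC t D × span D ⊆ span G)
  subcode? t {k} {m} {n} G =
    map′ (λ (D , D∈C , D⊆G) → D , D∈C , span-least D⊆G)
         (λ (D , D∈C , D⊆G) → D , D∈C , λ i → D⊆G (D i) (span-row D i))
         (search-Mat m n (λ D≗D′ (D∈C , D⊆G) → InC-resp t D≗D′ D∈C , λ i → span-resp (D≗D′ i) (D⊆G i))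
                         λ D → (rowsIndep? D ×-dec tColsIndep? t D) ×-dec all? λ i → span? G (D i))

  ⊆-span-or-outside : ∀ {k n} {X : Sub n} → X Respects _≗_ → Decidable X → (Z : Mat k n) →
                      (X ⊆ span Z) ⊎ ∃ λ v → X v × ¬ span Z v
  ⊆-span-or-outside {n = n} {X} resp X? Z with search-Vec n resp-outside (λ v → X? v ×-dec ¬? (span? Z v))
    where
    resp-outside : (λ v → X v × ¬ span Z v) Respects _≗_
    resp-outside v≗w (x , v∉Z) = resp v≗w x , v∉Z ∘ span-resp (sym ∘ v≗w)
  ... | yes outside = inj₂ outside
  ... | no  ∄outside = inj₁ λ v x → decidable-stable (span? Z v) λ v∉Z → ∄outside (v , x , v∉Z)

  InC-∷ : ∀ {t m n} {Z : Mat m n} {w} → InC t Z → ¬ span Z w → InC t (w ∷ Z)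
  InC-∷ {Z = Z} (rows , cols) w∉Z =
    rowsIndep-∷ {A = Z} rows w∉Z , λ f f-inj c wZ·c≡0 → cols f f-inj c (wZ·c≡0 ∘ suc)

  span-∩-⊆-projection : ∀ {k n} {Z P Y : Mat k n} {z : Vec n} (α : Vec k) → ¬ span Y z →
                        (∀ i → span Y (P i)) → (∀ i j → Z i j ≡ α i * z j + P i j) →
                        (span Z ∩ span Y) ⊆ span P
  span-∩-⊆-projection {k} {n} {Z} {P} {Y} {z} α z∉Y P⊆Y Z≡ v ((e , v≡) , v∈Y) = by-cases (α′ ≟ 0#)
    where
    α′ = Σᶠ k (λ i → e i * α i)
    s : Vec n
    s j = Σᶠ k (λ i → e i * P i j)
    s∈P : span P s
    s∈P = e , λ j → refl
    v≡α′z+s : ∀ j → v j ≡ α′ * z j + s j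
    v≡α′z+s j = begin
      v j                                         ≡⟨ v≡ j ⟩
      Σᶠ k (λ i → e i * Z i j)                    ≡⟨ Σᶠ-cong k (λ i → cong (e i *_) (Z≡ i j)) ⟩
      Σᶠ k (λ i → e i * (α i * z j + P i j))      ≡⟨ Σᶠ-cong k (λ i → trans (distribˡ (e i) _ _)
                                                       (cong (_+ e i * P i j) (sym (*-assoc (e i) (α i) (z j))))) ⟩
      Σᶠ k (λ i → e i * α i * z j + e i * P i j)  ≡⟨ Σᶠ-+ k _ _ ⟩
      Σᶠ k (λ i → e i * α i * z j) + s j          ≡⟨ cong (_+ s j) (Σᶠ-* k (z j) _) ⟨
      α′ * z j + s j                              ∎
    by-cases : Dec (α′ ≡ 0#) → span P v
    by-cases (yes α′≡0) = span-resp (λ j → sym (begin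
      v j             ≡⟨ v≡α′z+s j ⟩
      α′ * z j + s j  ≡⟨ cong (λ x → x * z j + s j) α′≡0 ⟩
      0# * z j + s j  ≡⟨ cong (_+ s j) (zeroˡ (z j)) ⟩
      0# + s j        ≡⟨ +-identityˡ (s j) ⟩
      s j             ∎)) s∈P
    by-cases (no α′≢0) = ⊥-elim (z∉Y (span-resp z≡ (span-* {G = Y} α′⁻¹ (span-sub v∈Y (span-least P⊆Y s s∈P)))))
      where
      α′⁻¹ = proj₁ (inverse α′ α′≢0)
      z≡ : ∀ j → α′⁻¹ * (v j - s j) ≡ z j
      z≡ j = begin
        α′⁻¹ * (v j - s j)               ≡⟨ cong (λ x → α′⁻¹ * (x - s j)) (v≡α′z+s j) ⟩
        α′⁻¹ * ((α′ * z j + s j) - s j)  ≡⟨ cong (α′⁻¹ *_) (//-rightDividesʳ (s j) (α′ * z j)) ⟩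
        α′⁻¹ * (α′ * z j)                ≡⟨ inverse-cancelˡ (proj₂ (inverse α′ α′≢0)) (z j) ⟩
        z j                              ∎

module CodeGraphs (F : FiniteField) (t n : ℕ) where
  open Codes F
  open LinearAlgebra F
  open CommutativeRing commutativeRing using (_*_; _+_)

  AdjΔ-respˡ : ∀ {m} {G G′ H : Mat m n} → span G ≐ span G′ → AdjΔ G′ H → AdjΔ G H
  AdjΔ-respˡ G≐G′ (d , d+1≡m , B , B-indep , B≐) =
    d , d+1≡m , B , B-indep , ≐-trans B≐ (∩-congˡ (≐-sym G≐G′))

  AdjΛ-respˡ : ∀ {k} {G G′ H : Mat k n} → span G ≐ span G′ → AdjΛ t G′ H → AdjΛ t G H
  AdjΛ-respˡ G≐G′ (d , d+1≡k , B , B∈C , B≐) =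
    d , d+1≡k , B , B∈C , ≐-trans B≐ (∩-congˡ (≐-sym G≐G′))

  module _ {m} {V : Mat m n → Set} {A : Mat m n → Mat m n → Set}
           (A-respˡ : ∀ {G G′ H} → span G ≐ span G′ → A G′ H → A G H) where

    Reach-respˡ : ∀ {G G′ H} → span G ≐ span G′ → Reach V A G′ H → Reach V A G H
    Reach-respˡ G≐G′ (same G′≐H)    = same (≐-trans G≐G′ G′≐H)
    Reach-respˡ G≐G′ (step adj v r) = step (A-respˡ G≐G′ adj) v r

    Reach-trans : ∀ {G H K} → Reach V A G H → Reach V A H K → Reach V A G K
    Reach-trans (same G≐H)     r′ = Reach-respˡ G≐H r′
    Reach-trans (step adj v r) r′ = step adj v (Reach-trans r r′)

  Λ̃-walk-trans : ∀ {m} {G H K : Mat m n} →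
                 Reach (VΛ̃ t) (AdjΛ t) G H → Reach (VΛ̃ t) (AdjΛ t) H K → Reach (VΛ̃ t) (AdjΛ t) G K
  Λ̃-walk-trans = Reach-trans (λ {G} {G′} {H} → AdjΛ-respˡ {G = G} {G′} {H})

  Δ-walk-trans : ∀ {m} {G H K : Mat m n} →
                 Reach (InC t) AdjΔ G H → Reach (InC t) AdjΔ H K → Reach (InC t) AdjΔ G K
  Δ-walk-trans = Reach-trans (λ {G} {G′} {H} → AdjΔ-respˡ {G = G} {G′} {H})

  subcode-of-nonIsolated : ∀ {m} {G : Mat (suc m) n} → VΛ̃ t G → ∃ λ (D : Mat m n) → InC t D × span D ⊆ span G
  subcode-of-nonIsolated {G = G} (_ , nonIsolated) = decidable-stable (subcode? t G) nonIsolated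

  Λ̃-reach-via-subcode : ∀ {m} {G H : Mat (suc m) n} {Z : Mat m n} → InC t H → InC t Z →
                        span Z ⊆ span G → span Z ⊆ span H → Reach (VΛ̃ t) (AdjΛ t) G H
  Λ̃-reach-via-subcode {m} {G} {H} {Z} H∈C Z∈C Z⊆G Z⊆H
    with ⊆-span-or-outside {X = span G ∩ span H}
                            (λ v≗w (g , h) → span-resp {G = G} v≗w g , span-resp {G = H} v≗w h)
                            (λ v → span? G v ×-dec span? H v) Z
  ... | inj₁ G∩H⊆Z = step adjacent (H∈C , λ isolated → isolated (Z , Z∈C , Z⊆H)) (same {G = H} ≐-refl)
    where
    adjacent : AdjΛ t G H
    adjacent = m , refl , Z , Z∈C , (λ v z → Z⊆G v z , Z⊆H v z) , G∩H⊆Z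
  ... | inj₂ (v , (v∈G , v∈H) , v∉Z) = same (≐-trans (≐-sym (vZ≐ {G} v∈G Z⊆G)) (vZ≐ {H} v∈H Z⊆H))
    where
    vZ≐ : ∀ {X : Mat (suc m) n} → span X v → span Z ⊆ span X → span (v ∷ Z) ≐ span X
    vZ≐ {X} v∈X Z⊆X = rowsIndep-span-≐ (v ∷ Z) X (rowsIndep-∷ {A = Z} (proj₁ Z∈C) v∉Z) ≤-refl
                    λ { zero → v∈X ; (suc i) → Z⊆X (Z i) (span-row Z i) }

  adjΔ-extension : ∀ {m} {Z Z′ : Mat m n} → RowsIndep Z′ → AdjΔ Z Z′ →
                   ∃ λ w → ¬ span Z w × span Z′ ⊆ span (w ∷ Z)
  adjΔ-extension {Z = Z} {Z′} Z′-indep (d , refl , B , B-indep , B⊆Z∩Z′ , Z∩Z′⊆B)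
    with ⊆-span-or-outside (span-resp {G = Z′}) (span? Z′) Z
  ... | inj₁ Z′⊆Z = ⊥-elim (n≮n d (rowsIndep-≤ Z′ B Z′-indep λ i →
                      Z∩Z′⊆B (Z′ i) (Z′⊆Z (Z′ i) (span-row Z′ i) , span-row Z′ i)))
  ... | inj₂ (w , w∈Z′ , w∉Z) =
    w , w∉Z , ⊆-trans (proj₂ wB≐Z′) (span-∷-mono {A = B} {B = Z} (λ v → proj₁ ∘ B⊆Z∩Z′ v))
    where
    wB≐Z′ : span (w ∷ B) ≐ span Z′
    wB≐Z′ = rowsIndep-span-≐ (w ∷ B) Z′ (rowsIndep-∷ {A = B} B-indep (w∉Z ∘ proj₁ ∘ B⊆Z∩Z′ w)) ≤-refl
              λ { zero → w∈Z′ ; (suc i) → proj₂ (B⊆Z∩Z′ (B i) (span-row B i)) }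

  lift-Δ-walk : ∀ {m} {Z D : Mat m n} → Reach (InC t) AdjΔ Z D →
                ∀ {G H : Mat (suc m) n} → InC t H → InC t Z → span Z ⊆ span G → span D ⊆ span H →
                Reach (VΛ̃ t) (AdjΛ t) G H
  lift-Δ-walk (same Z≐D) H∈C Z∈C Z⊆G D⊆H = Λ̃-reach-via-subcode H∈C Z∈C Z⊆G (⊆-trans (proj₁ Z≐D) D⊆H)
  lift-Δ-walk {Z = Z} (step {G' = Z′} adj Z′∈C walk) {G} H∈C Z∈C Z⊆G D⊆H =
    Λ̃-walk-trans {H = W} (Λ̃-reach-via-subcode {G = G} W∈C Z∈C Z⊆G (span-tail {G = W}))
                  (lift-Δ-walk walk H∈C Z′∈C Z′⊆W D⊆H)
    where
    extension = adjΔ-extension (proj₁ Z′∈C) adj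
    W = proj₁ extension ∷ Z
    W∈C : InC t W
    W∈C = InC-∷ Z∈C (proj₁ (proj₂ extension))
    Z′⊆W = proj₂ (proj₂ extension)

  adjΔ-within : ∀ {k} {Z Y : Mat (suc k) n} {z} → RowsIndep Z → span Z z → ¬ span Y z →
                (∀ i → span (z ∷ Y) (Z i)) → AdjΔ Z Y
  adjΔ-within {k} {Z} {Y} {z} Z-indep z∈Z z∉Y Z⊆zY = from-basis (span-hasDim P)
    where
    α : Vec (suc k)
    α i = proj₁ (Z⊆zY i) zero
    -- Z i = α i z + P i with P i ∈ Y; the P i span Z ∩ Y.
    P : Mat (suc k) n
    P i j = Σᶠ (suc k) (λ r → proj₁ (Z⊆zY i) (suc r) * Y r j)
    P⊆Y : ∀ i → span Y (P i)
    P⊆Y i = proj₁ (Z⊆zY i) ∘ suc , λ j → refl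
    Z≡ : ∀ i j → Z i j ≡ α i * z j + P i j
    Z≡ i = proj₂ (Z⊆zY i)
    P⊆Z : ∀ i → span Z (P i)
    P⊆Z i = span-+-cancelˡ {G = Z} (span-resp {G = Z} (Z≡ i) (span-row Z i)) (span-* {G = Z} (α i) z∈Z)
    Z∩Y≐P : (span Z ∩ span Y) ≐ span P
    Z∩Y≐P = span-∩-⊆-projection {Z = Z} {P} {Y} α z∉Y P⊆Y Z≡
          , λ v v∈P → span-least {G = Z} P⊆Z v v∈P , span-least {G = Y} P⊆Y v v∈P
    from-basis : (∃ λ d → HasDim d (span P)) → AdjΔ Z Y
    from-basis (d , B , B-indep , B≐P) =
      d , cong suc (≤-antisym (≤-pred d+1≤k+1) (≤-pred k+1≤d+1)) , B , B-indep , ≐-trans B≐P (≐-sym Z∩Y≐P)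
      where
      d+1≤k+1 : suc d ≤ suc k
      d+1≤k+1 = rowsIndep-≤ (z ∷ B) Z (rowsIndep-∷ {A = B} B-indep (z∉Y ∘ span-least {G = Y} P⊆Y z ∘ proj₁ B≐P z))
                  λ { zero → z∈Z ; (suc i) → span-least {G = Z} P⊆Z (B i) (proj₁ B≐P (B i) (span-row B i)) }
      k+1≤d+1 : suc k ≤ suc d
      k+1≤d+1 = rowsIndep-≤ Z (z ∷ B) Z-indep λ i → span-resp {G = z ∷ B} (sym ∘ Z≡ i)
                  (span-+ {G = z ∷ B} (span-* {G = z ∷ B} (α i) (span-row (z ∷ B) zero))
                          (span-tail {G = z ∷ B} (P i) (proj₂ B≐P (P i) (span-row P i))))

  Δ-reach-within : ∀ {k} {Z Y : Mat k n} (W : Mat (suc k) n) → InC t Z → InC t Y →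
                   span Z ⊆ span W → span Y ⊆ span W → Reach (InC t) AdjΔ Z Y
  Δ-reach-within {zero} {Z} {Y} _ _ _ _ _ = same {G = Z} {H = Y} ≐-refl   -- both spans are {0}
  Δ-reach-within {suc k} {Z} {Y} W (Z-indep , _) Y∈C Z⊆W Y⊆W
    with ⊆-span-or-outside (span-resp {G = Z}) (span? Z) Y
  ... | inj₁ Z⊆Y = same (rowsIndep-span-≐ Z Y Z-indep ≤-refl λ i → Z⊆Y (Z i) (span-row Z i))
  ... | inj₂ (z , z∈Z , z∉Y) = step (adjΔ-within {Y = Y} Z-indep z∈Z z∉Y Z⊆zY) Y∈C (same {G = Y} ≐-refl)
    where
    zY≐W : span (z ∷ Y) ≐ span W
    zY≐W = rowsIndep-span-≐ (z ∷ Y) W (rowsIndep-∷ {A = Y} (proj₁ Y∈C) z∉Y) ≤-refl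
             λ { zero → Z⊆W z z∈Z ; (suc i) → Y⊆W (Y i) (span-row Y i) }
    Z⊆zY : ∀ i → span (z ∷ Y) (Z i)
    Z⊆zY i = proj₂ zY≐W (Z i) (Z⊆W (Z i) (span-row Z i))

  project-Λ̃-walk : ∀ {m} {W Y : Mat (suc m) n} → Reach (VΛ̃ t) (AdjΛ t) W Y →
                   ∀ {Z Y′ : Mat m n} → InC t Z → InC t Y′ → span Z ⊆ span W → span Y′ ⊆ span Y →
                   Reach (InC t) AdjΔ Z Y′
  project-Λ̃-walk {W = W} (same W≐Y) Z∈C Y′∈C Z⊆W Y′⊆Y =
    Δ-reach-within W Z∈C Y′∈C Z⊆W (⊆-trans Y′⊆Y (proj₂ W≐Y))
  project-Λ̃-walk {W = W} (step (_ , refl , U , U∈C , U⊆W∩W′ , _) _ walk) Z∈C Y′∈C Z⊆W Y′⊆Y =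
    Δ-walk-trans {H = U} (Δ-reach-within W Z∈C U∈C Z⊆W (λ v → proj₁ ∘ U⊆W∩W′ v))
                         (project-Λ̃-walk walk U∈C Y′∈C (λ v → proj₂ ∘ U⊆W∩W′ v) Y′⊆Y)

  Δ⇒Λ̃ : ∀ {m} → ConnectedΔ t n m → ConnectedΛ̃ t n (suc m)
  Δ⇒Λ̃ connected G H G∈V H∈V =
    let D , D∈C , D⊆G = subcode-of-nonIsolated {G = G} G∈V
        E , E∈C , E⊆H = subcode-of-nonIsolated {G = H} H∈V
    in  lift-Δ-walk (connected D E D∈C E∈C) {G} {H} (proj₁ H∈V) D∈C D⊆G E⊆H

  Λ̃⇒Δ : ∀ {m} → m < n → ConnectedΛ̃ t n (suc m) → ConnectedΔ t n m
  Λ̃⇒Δ {m} m<n connected X Y X∈C Y∈C =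
    project-Λ̃-walk (connected (enlarge X) (enlarge Y) (enlarge∈V X∈C) (enlarge∈V Y∈C)) X∈C Y∈C
                   (span-tail {G = enlarge X}) (span-tail {G = enlarge Y})
    where
    enlarge : Mat m n → Mat (suc m) n
    enlarge X = proj₁ (span-proper X m<n) ∷ X
    enlarge∈V : ∀ {X} → InC t X → VΛ̃ t (enlarge X)
    enlarge∈V {X} X∈C = InC-∷ X∈C (proj₂ (span-proper X m<n))
                      , λ isolated → isolated (X , X∈C , span-tail {G = enlarge X})

  isolated-no-edges : ∀ {m} {G H : Mat (suc m) n} → Isolated t G → ¬ AdjΛ t G H × ¬ AdjΛ t H G
  isolated-no-edges isolated =
      (λ { (_ , refl , B , B∈C , B⊆G∩H , _) → isolated (B , B∈C , λ v → proj₁ ∘ B⊆G∩H v) })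
    , (λ { (_ , refl , B , B∈C , B⊆H∩G , _) → isolated (B , B∈C , λ v → proj₂ ∘ B⊆H∩G v) })

theorem1p4 : (F : FiniteField) → let open Codes F in
    (n k t : ℕ) → 0 < k → k < n → t ≤ k →
    (ConnectedΔ t n (k ∸ 1) ⇔ ConnectedΛ̃ t n k)
    × (∀ {G H : Mat k n} → InC t G → InC t H → Isolated t G →
         ¬ AdjΛ t G H × ¬ AdjΛ t H G)
theorem1p4 F n (suc m) t _ m+1<n _ =
  mk⇔ Δ⇒Λ̃ (Λ̃⇒Δ (<⇒≤ m+1<n)) , λ {G} {H} _ _ → isolated-no-edges {G = G} {H}
  where open CodeGraphs F t n
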